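{- Let $a,b$ be integers with $a^4\neq 1024b$ and let $g=\gcd(32,8a,a^2)$. If $(x,y)\in\mathbb{Z}^2$ satisfies $x^4-4y^2+axy+b=0$, then there exists an integer divisor $d_1$ of $\frac{a^4-1024b}{g^2}$ such that $$64x^2=d_1g+\frac{a^4-1024b}{d_1g}-2a^2.$$ -}

module Defs where

open import Data.Integer using (ℤ; _+_; _-_; _*_; _^_)
open import Data.Integer.GCD using (gcd)

gOf : ℤ → ℤ
gOf a = gcd (ℤ.pos 32) (gcd (ℤ.pos 8 * a) (a ^ 2))

Δ : ℤ → ℤ → ℤ
Δ a b = a ^ 4 - ℤ.pos 1024 * b

{-# OPTIONS --safe #-}
-- Writing s = 32x² + a² and t = 64y − 8ax, one has
--   s² − t² = a⁴ − 1024b + 1024 (x⁴ − 4y² + axy + b),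
-- so a solution makes (s − t)(s + t) = a⁴ − 1024b. Since g = gcd(32, 8a, a²)
-- divides both s and t, it divides s ∓ t; taking d₁ = (s − t)/g, the
-- complementary factor is (s + t)/g, and 64x² = 2s − 2a² = (s − t) + (s + t) − 2a².
module Submission where

open import Defs
open import Data.Integer using (ℤ; _+_; _-_; _*_; _^_)
open import Data.Integer.Properties using (+-identityʳ; *-commutativeSemigroup)
open import Algebra.Properties.CommutativeSemigroup *-commutativeSemigroup using (interchange)
open import Data.Integer.GCD using (gcd; gcd[i,j]∣i; gcd[i,j]∣j)
open import Data.Integer.Divisibility.Signed
  using (_∣_; divides; ∣ᵤ⇒∣; ∣-trans; ∣m∣n⇒∣m+n; ∣m∣n⇒∣m-n; ∣m⇒∣m*n; ∣n⇒∣m*n)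
open import Data.Integer.Solver using (module +-*-Solver)
open import Data.Integer.Tactic.RingSolver using (solve-∀)
open import Data.Product using (∃-syntax; _×_; _,_)
open import Relation.Binary.PropositionalEquality
  using (_≡_; _≢_; refl; sym; trans; cong; cong₂; module ≡-Reasoning)

open +-*-Solver using (solve; _:+_; _:-_; _:*_; _:^_; _:=_; con)

s : ℤ → ℤ → ℤ
s a x = ℤ.pos 32 * x ^ 2 + a ^ 2

t : ℤ → ℤ → ℤ → ℤ
t a x y = ℤ.pos 64 * y - ℤ.pos 8 * a * x

s²-t²≡Δ+1024·quartic : ∀ a b x y →
  s a x * s a x - t a x y * t a x y
    ≡ Δ a b + ℤ.pos 1024 * (x ^ 4 - ℤ.pos 4 * y ^ 2 + a * x * y + b)
s²-t²≡Δ+1024·quartic = solve 4 (λ a b x y →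
  let S = con (ℤ.pos 32) :* x :^ 2 :+ a :^ 2
      T = con (ℤ.pos 64) :* y :- con (ℤ.pos 8) :* a :* x
  in S :* S :- T :* T
     := (a :^ 4 :- con (ℤ.pos 1024) :* b)
        :+ con (ℤ.pos 1024) :* (x :^ 4 :- con (ℤ.pos 4) :* y :^ 2 :+ a :* x :* y :+ b))
  refl

64x²≡2s-2a² : ∀ a x → ℤ.pos 64 * x ^ 2 ≡ ℤ.pos 2 * s a x - ℤ.pos 2 * a ^ 2
64x²≡2s-2a² = solve 2 (λ a x →
  con (ℤ.pos 64) :* x :^ 2
    := con (ℤ.pos 2) :* (con (ℤ.pos 32) :* x :^ 2 :+ a :^ 2) :- con (ℤ.pos 2) :* a :^ 2)
  refl

difference-of-squares≡Δ : ∀ a b x y → x ^ 4 - ℤ.pos 4 * y ^ 2 + a * x * y + b ≡ ℤ.pos 0 →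
  s a x * s a x - t a x y * t a x y ≡ Δ a b
difference-of-squares≡Δ a b x y quartic≡0 = begin
  s a x * s a x - t a x y * t a x y                                     ≡⟨ s²-t²≡Δ+1024·quartic a b x y ⟩
  Δ a b + ℤ.pos 1024 * (x ^ 4 - ℤ.pos 4 * y ^ 2 + a * x * y + b)      ≡⟨ cong (λ q → Δ a b + ℤ.pos 1024 * q) quartic≡0 ⟩
  Δ a b + ℤ.pos 0                                                       ≡⟨ +-identityʳ (Δ a b) ⟩
  Δ a b                                                                 ∎
  where open ≡-Reasoning

factor-pair : ∀ {g u v} → g ∣ u → g ∣ v →
  ∃[ d ] ∃[ e ] ((d * e) * (g * g) ≡ u * u - v * v × d * g + e * g ≡ ℤ.pos 2 * u)
factor-pair {g} {u} {v} g∣u g∣v with ∣m∣n⇒∣m-n g∣u g∣v | ∣m∣n⇒∣m+n g∣u g∣v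
... | divides d u-v≡dg | divides e u+v≡eg = d , e , product , sum
  where
  open ≡-Reasoning
  difference-of-squares : ∀ u v → (u - v) * (u + v) ≡ u * u - v * v
  difference-of-squares = solve-∀
  [u-v]+[u+v]≡2u : ∀ u v → (u - v) + (u + v) ≡ ℤ.pos 2 * u
  [u-v]+[u+v]≡2u = solve-∀
  product : (d * e) * (g * g) ≡ u * u - v * v
  product = begin
    (d * e) * (g * g)  ≡⟨ interchange d e g g ⟩
    (d * g) * (e * g)  ≡⟨ cong₂ _*_ (sym u-v≡dg) (sym u+v≡eg) ⟩
    (u - v) * (u + v)  ≡⟨ difference-of-squares u v ⟩
    u * u - v * v      ∎
  sum : d * g + e * g ≡ ℤ.pos 2 * u
  sum = begin
    d * g + e * g      ≡⟨ cong₂ _+_ (sym u-v≡dg) (sym u+v≡eg) ⟩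
    (u - v) + (u + v)  ≡⟨ [u-v]+[u+v]≡2u u v ⟩
    ℤ.pos 2 * u        ∎

signed-gcd[i,j]∣i : ∀ i j → gcd i j ∣ i
signed-gcd[i,j]∣i i j = ∣ᵤ⇒∣ {gcd i j} {i} (gcd[i,j]∣i i j)

signed-gcd[i,j]∣j : ∀ i j → gcd i j ∣ j
signed-gcd[i,j]∣j i j = ∣ᵤ⇒∣ {gcd i j} {j} (gcd[i,j]∣j i j)

gcd[i,gcd[j,k]]∣j : ∀ i j k → gcd i (gcd j k) ∣ j
gcd[i,gcd[j,k]]∣j i j k = ∣-trans (signed-gcd[i,j]∣j i (gcd j k)) (signed-gcd[i,j]∣i j k)

gcd[i,gcd[j,k]]∣k : ∀ i j k → gcd i (gcd j k) ∣ k
gcd[i,gcd[j,k]]∣k i j k = ∣-trans (signed-gcd[i,j]∣j i (gcd j k)) (signed-gcd[i,j]∣j j k)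

gOf∣32 : ∀ a → gOf a ∣ ℤ.pos 32
gOf∣32 a = signed-gcd[i,j]∣i (ℤ.pos 32) (gcd (ℤ.pos 8 * a) (a ^ 2))

gOf∣s : ∀ a x → gOf a ∣ s a x
gOf∣s a x = ∣m∣n⇒∣m+n (∣m⇒∣m*n (x ^ 2) (gOf∣32 a)) (gcd[i,gcd[j,k]]∣k (ℤ.pos 32) (ℤ.pos 8 * a) (a ^ 2))

gOf∣t : ∀ a x y → gOf a ∣ t a x y
gOf∣t a x y = ∣m∣n⇒∣m-n (∣m⇒∣m*n y gOf∣64) (∣m⇒∣m*n x (gcd[i,gcd[j,k]]∣j (ℤ.pos 32) (ℤ.pos 8 * a) (a ^ 2)))
  where
  gOf∣64 : gOf a ∣ ℤ.pos 64
  gOf∣64 = ∣n⇒∣m*n (ℤ.pos 2) (gOf∣32 a)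

-- The hypothesis a⁴ ≠ 1024b only keeps (a⁴ − 1024b)/g² nonzero; the factorisation does not need it.
theorem4p7 : (a b : ℤ) → a ^ 4 ≢ ℤ.pos 1024 * b →
    (x y : ℤ) → x ^ 4 - ℤ.pos 4 * y ^ 2 + a * x * y + b ≡ ℤ.pos 0 →
    ∃[ d₁ ] ∃[ e ] ((d₁ * e) * (gOf a * gOf a) ≡ Δ a b
      × ℤ.pos 64 * x ^ 2 ≡ d₁ * gOf a + e * gOf a - ℤ.pos 2 * a ^ 2)
-- A `let`, not `with`: with-abstraction normalises the goal, unfolding the gcd inside gOf a.
theorem4p7 a b _ x y quartic≡0 =
  let d₁ , e , product , sum = factor-pair (gOf∣s a x) (gOf∣t a x y)
  in d₁ , e , trans product (difference-of-squares≡Δ a b x y quartic≡0) , (begin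
    ℤ.pos 64 * x ^ 2                         ≡⟨ 64x²≡2s-2a² a x ⟩
    ℤ.pos 2 * s a x - ℤ.pos 2 * a ^ 2        ≡⟨ cong (_- ℤ.pos 2 * a ^ 2) (sym sum) ⟩
    d₁ * gOf a + e * gOf a - ℤ.pos 2 * a ^ 2 ∎)
  where open ≡-Reasoning
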